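{- Let $G$ be a finite simple connected undirected graph on vertex set $V=\{1,\dots,n\}$ with $m$ edges. Let $Z=(I-P+W_v)^{ -1}$ and $Z_e=(I-P_e+W_e)^{ -1}$ be the fundamental matrices of the simple random walk on the vertices and on the directed edges of $G$, respectively. Then \[ Z = I + D^{ -1}TZ_eS - W_v = D^{ -1}TZ_eT^{\top}. \]
   Context: $d_i=\deg(i)$, $D=\mathrm{diag}(d_1,\dots,d_n)$, $A$ the adjacency matrix, and $P=D^{ -1}A$ the transition matrix of the simple random walk on vertices. The set $\hat E$ of directed edges consists of the $2m$ ordered pairs $(i,j)$ with $\{i,j\}$ an edge. $P_e$ is the $2m\times 2m$ transition matrix of the simple random walk on directed edges: $P_e((i,j),(k,\ell))=\frac1{d_j}$ if $k=j$ (any neighbor $\ell$ of $j$, including $\ell=i$), and $0$ otherwise. $S$ is the $2m\times n$ matrix with $S((i,j),x)=1$ if $j=x$ and $0$ otherwise; $T$ is the $n\times 2m$ matrix with $T(x,(i,j))=1$ if $i=x$ and $0$ otherwise. $\pi\in\mathbb R^n$ has $\pi_i=d_i/(2m)$, $\pi_e=\frac1{2m}\mathbb 1\in\mathbb R^{2m}$, $W_v=\mathbb 1\pi^\top$, $W_e=\mathbb 1\pi_e^\top$. -}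

module Defs where

open import Data.Nat as ℕ using (ℕ; zero; suc)
open import Data.Integer using (+_)
open import Data.Rational using (ℚ; 0ℚ; 1ℚ; _+_; _*_; _-_; _/_)
open import Data.Fin using (Fin; zero; suc)
open import Data.Fin.Properties using () renaming (_≟_ to _≟ᶠ_)
open import Data.Bool using (Bool; true; false; if_then_else_)
open import Data.List using (List; length; filterᵇ; cartesianProduct; allFin; lookup)
open import Data.Product using (_×_; _,_; proj₁; proj₂)
open import Relation.Nullary.Decidable using (⌊_⌋)
open import Relation.Binary.PropositionalEquality using (_≡_)

Matrix : ℕ → ℕ → Set
Matrix a b = Fin a → Fin b → ℚ

∑ : ∀ {k} → (Fin k → ℚ) → ℚ
∑ {zero}  f = 0ℚ
∑ {suc k} f = f zero + ∑ (λ i → f (suc i))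

infixl 7 _⊗_
infixl 6 _⊕_ _⊖_
infix 4 _≈ₘ_

_⊗_ : ∀ {a b c} → Matrix a b → Matrix b c → Matrix a c
(M ⊗ N) i j = ∑ (λ k → M i k * N k j)

_⊕_ : ∀ {a b} → Matrix a b → Matrix a b → Matrix a b
(M ⊕ N) i j = M i j + N i j

_⊖_ : ∀ {a b} → Matrix a b → Matrix a b → Matrix a b
(M ⊖ N) i j = M i j - N i j

_ᵀ : ∀ {a b} → Matrix a b → Matrix b a
(M ᵀ) i j = M j i

δ : ∀ {k} → Fin k → Fin k → ℚ
δ i j = if ⌊ i ≟ᶠ j ⌋ then 1ℚ else 0ℚ

Id : ∀ {a} → Matrix a a
Id = δ

_≈ₘ_ : ∀ {a b} → Matrix a b → Matrix a b → Set
M ≈ₘ N = ∀ i j → M i j ≡ N i j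

-- reciprocal of a natural number as a rational; only ever applied to
-- nonzero arguments in the statement (convention 1/0 := 0 is irrelevant)
recipℕ : ℕ → ℚ
recipℕ zero    = 0ℚ
recipℕ (suc k) = + 1 / suc k

ℕtoℚ : ℕ → ℚ
ℕtoℚ k = + k / 1

Adjacency : ℕ → Set
Adjacency n = Fin n → Fin n → Bool

Symmetric : ∀ {n} → Adjacency n → Set
Symmetric A = ∀ i j → A i j ≡ A j i

Loopless : ∀ {n} → Adjacency n → Set
Loopless A = ∀ i → A i i ≡ false

data Reach {n} (A : Adjacency n) : Fin n → Fin n → Set where
  here : ∀ {i} → Reach A i i
  step : ∀ {i j k} → A i j ≡ true → Reach A j k → Reach A i k

Connected : ∀ {n} → Adjacency n → Set
Connected A = ∀ i j → Reach A i j

module Walks {n : ℕ} (A : Adjacency n) where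

  deg : Fin n → ℕ
  deg i = length (filterᵇ (A i) (allFin n))

  -- the set Ê of directed edges (ordered pairs (i,j) with {i,j} an edge);
  -- it has 2m elements
  dedges : List (Fin n × Fin n)
  dedges = filterᵇ (λ p → A (proj₁ p) (proj₂ p)) (cartesianProduct (allFin n) (allFin n))

  2m : ℕ
  2m = length dedges

  edge : Fin 2m → Fin n × Fin n
  edge = lookup dedges

  tail head : Fin 2m → Fin n
  tail e = proj₁ (edge e)
  head e = proj₂ (edge e)

  Aℚ : Matrix n n
  Aℚ i j = if A i j then 1ℚ else 0ℚ

  Dinv : Matrix n n
  Dinv i j = δ i j * recipℕ (deg i)

  P : Matrix n n
  P i j = (if A i j then 1ℚ else 0ℚ) * recipℕ (deg i)

  Pe : Matrix 2m 2m
  Pe e f = δ (head e) (tail f) * recipℕ (deg (head e))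

  S : Matrix 2m n
  S e x = δ (head e) x

  T : Matrix n 2m
  T x e = δ (tail e) x

  π : Fin n → ℚ
  π i = ℕtoℚ (deg i) * recipℕ 2m

  πe : Fin 2m → ℚ
  πe e = recipℕ 2m

  Wv : Matrix n n
  Wv i j = π j

  We : Matrix 2m 2m
  We e f = πe f

  Mv : Matrix n n
  Mv = Id ⊖ P ⊕ Wv

  Me : Matrix 2m 2m
  Me = Id ⊖ Pe ⊕ We

  IsInverse : ∀ {k} → Matrix k k → Matrix k k → Set
  IsInverse Z M = (Z ⊗ M ≈ₘ Id) × (M ⊗ Z ≈ₘ Id)

module Submission where

open import Defs

open import Data.Nat using (ℕ; zero; suc; _≤_; s≤s; NonZero)
import Data.Integer as ℤ
import Data.Integer.Properties as ℤ
import Data.Nat.Coprimality as Coprime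
open import Data.Rational using (ℚ; 0ℚ; 1ℚ; _+_; _*_; _-_; -_; mkℚ; _/_)
open import Data.Rational.Properties
  using (normalize-coprime; *-inverseˡ; *-comm; *-assoc; *-identityˡ; *-identityʳ;
         *-zeroˡ; *-zeroʳ; +-identityˡ; +-identityʳ; neg-distrib-+; *-distribˡ-+)
open import Data.Rational.Solver using (module +-*-Solver)
open +-*-Solver using (solve; _:+_; _:*_; _:-_; _:=_; con)
open import Data.Fin using (Fin; zero; suc; _≟_)
open import Data.Bool using (Bool; true; false; if_then_else_)
open import Data.Bool.Properties using (T-≡)
open import Data.List
  using (List; []; _∷_; length; filterᵇ; cartesianProduct; allFin; lookup; tabulate; map; _++_)
open import Data.List.Membership.Propositional using (_∈_)
open import Data.List.Membership.Propositional.Properties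
  using (∈-allFin; ∈-cartesianProduct⁺; ∈-filter⁺)
open import Data.List.Relation.Unary.Any using (here; there)
open import Data.Product using (_×_; _,_; proj₁; proj₂; ∃-syntax)
open import Data.Empty using (⊥-elim)
open import Function using (_∘_; id)
open import Function.Bundles using (Equivalence)
open import Relation.Binary.Bundles using (Setoid)
import Relation.Binary.Reasoning.Setoid as SetoidReasoning
open import Relation.Binary.PropositionalEquality
open import Relation.Nullary using (yes; no; ¬_)
open import Relation.Nullary.Decidable using (T?)

-- Put Y := I + D⁻¹TZₑS − Wᵥ.  The walk on directed edges projects onto the walk on
-- vertices through the head map S: since Pₑ = S D⁻¹T and P = D⁻¹TS, we get the
-- intertwining S (I − P + Wᵥ) = (I − Pₑ + Wₑ) S, and with Wᵥ (I − P + Wᵥ) = Wᵥ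
-- (stationarity of π) this gives Y (I − P + Wᵥ) = I, so Y = Z.  For the second formula,
-- (I − Pₑ + Wₑ) Tᵀ = Tᵀ − S + 𝟙πᵀ and Zₑ fixes 𝟙πᵀ, whence Zₑ Tᵀ = Tᵀ + Zₑ S − 𝟙πᵀ;
-- multiply on the left by D⁻¹T and use D⁻¹T Tᵀ = I.

ℕtoℚ≡mkℚ : ∀ k → ℕtoℚ k ≡ mkℚ (ℤ.+ k) 0 (Coprime.sym (Coprime.1-coprimeTo k))
ℕtoℚ≡mkℚ k = normalize-coprime (Coprime.sym (Coprime.1-coprimeTo k))

recipℕ-suc≡mkℚ : ∀ k → recipℕ (suc k) ≡ mkℚ (ℤ.+ 1) k (Coprime.1-coprimeTo (suc k))
recipℕ-suc≡mkℚ k = normalize-coprime (Coprime.1-coprimeTo (suc k))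

ℕtoℚ-suc : ∀ k → ℕtoℚ (suc k) ≡ 1ℚ + ℕtoℚ k
ℕtoℚ-suc k rewrite ℕtoℚ≡mkℚ k =
  cong (_/ 1) (sym (cong (λ z → ℤ.+ 1 ℤ.+ z) (ℤ.*-identityʳ (ℤ.+ k))))

recipℕ-inverseˡ : ∀ k → .{{NonZero k}} → recipℕ k * ℕtoℚ k ≡ 1ℚ
recipℕ-inverseˡ (suc k) rewrite recipℕ-suc≡mkℚ k | ℕtoℚ≡mkℚ (suc k) =
  *-inverseˡ (mkℚ (ℤ.+ suc k) 0 (Coprime.sym (Coprime.1-coprimeTo (suc k))))

∑-cong : ∀ {k} {f g : Fin k → ℚ} → (∀ i → f i ≡ g i) → ∑ f ≡ ∑ g
∑-cong {zero}  _   = refl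
∑-cong {suc k} f≗g = cong₂ _+_ (f≗g zero) (∑-cong (f≗g ∘ suc))

∑-zero : ∀ k → ∑ {k} (λ _ → 0ℚ) ≡ 0ℚ
∑-zero zero    = refl
∑-zero (suc k) = cong (0ℚ +_) (∑-zero k)

∑-distrib-+ : ∀ {k} (f g : Fin k → ℚ) → ∑ (λ i → f i + g i) ≡ ∑ f + ∑ g
∑-distrib-+ {zero}  f g = refl
∑-distrib-+ {suc k} f g rewrite ∑-distrib-+ (f ∘ suc) (g ∘ suc) =
  solve 4 (λ a b c d → (a :+ b) :+ (c :+ d) := (a :+ c) :+ (b :+ d)) refl
    (f zero) (g zero) (∑ (f ∘ suc)) (∑ (g ∘ suc))

∑-neg : ∀ {k} (f : Fin k → ℚ) → ∑ (λ i → - f i) ≡ - ∑ f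
∑-neg {zero}  f = refl
∑-neg {suc k} f rewrite ∑-neg (f ∘ suc) = sym (neg-distrib-+ (f zero) (∑ (f ∘ suc)))

∑-distrib-- : ∀ {k} (f g : Fin k → ℚ) → ∑ (λ i → f i - g i) ≡ ∑ f - ∑ g
∑-distrib-- f g = trans (∑-distrib-+ f (λ i → - g i)) (cong (∑ f +_) (∑-neg g))

*-distribˡ-∑ : ∀ {k} c (f : Fin k → ℚ) → ∑ (λ i → c * f i) ≡ c * ∑ f
*-distribˡ-∑ {zero}  c f = sym (*-zeroʳ c)
*-distribˡ-∑ {suc k} c f rewrite *-distribˡ-∑ c (f ∘ suc) =
  sym (*-distribˡ-+ c (f zero) (∑ (f ∘ suc)))

*-distribʳ-∑ : ∀ {k} c (f : Fin k → ℚ) → ∑ (λ i → f i * c) ≡ ∑ f * c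
*-distribʳ-∑ c f =
  trans (∑-cong (λ i → *-comm (f i) c)) (trans (*-distribˡ-∑ c f) (*-comm c (∑ f)))

∑-comm : ∀ {a b} (f : Fin a → Fin b → ℚ) → ∑ (λ i → ∑ (f i)) ≡ ∑ (λ j → ∑ (λ i → f i j))
∑-comm {zero}  {b} f = sym (∑-zero b)
∑-comm {suc a}     f = trans (cong (∑ (f zero) +_) (∑-comm (f ∘ suc)))
                             (sym (∑-distrib-+ (f zero) (λ j → ∑ (λ i → f (suc i) j))))

∑-const : ∀ k c → ∑ {k} (λ _ → c) ≡ ℕtoℚ k * c
∑-const zero    c = sym (*-zeroˡ c)
∑-const (suc k) c rewrite ∑-const k c | ℕtoℚ-suc k =
  solve 2 (λ c n → c :+ n :* c := (con 1ℚ :+ n) :* c) refl c (ℕtoℚ k)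

δ-suc : ∀ {k} (i j : Fin k) → δ (suc i) (suc j) ≡ δ i j
δ-suc i j with i ≟ j
... | yes _ = refl
... | no  _ = refl

δ-refl : ∀ {k} (i : Fin k) → δ i i ≡ 1ℚ
δ-refl zero    = refl
δ-refl (suc i) = trans (δ-suc i i) (δ-refl i)

δ-≢ : ∀ {k} {i j : Fin k} → ¬ i ≡ j → δ i j ≡ 0ℚ
δ-≢ {i = i} {j} i≢j with i ≟ j
... | yes i≡j = ⊥-elim (i≢j i≡j)
... | no  _   = refl

δ-sym : ∀ {k} (i j : Fin k) → δ i j ≡ δ j i
δ-sym i j with i ≟ j
... | yes refl = sym (δ-refl i)
... | no  i≢j  = sym (δ-≢ (i≢j ∘ sym))

∑-δˡ : ∀ {k} (i : Fin k) (f : Fin k → ℚ) → ∑ (λ j → δ i j * f j) ≡ f i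
∑-δˡ {suc k} zero f = begin
  1ℚ * f zero + ∑ (λ j → 0ℚ * f (suc j)) ≡⟨ cong₂ _+_ (*-identityˡ (f zero))
                                                      (∑-cong (λ j → *-zeroˡ (f (suc j)))) ⟩
  f zero + ∑ {k} (λ _ → 0ℚ)              ≡⟨ cong (f zero +_) (∑-zero k) ⟩
  f zero + 0ℚ                            ≡⟨ +-identityʳ (f zero) ⟩
  f zero                                 ∎
  where open ≡-Reasoning
∑-δˡ {suc k} (suc i) f = begin
  0ℚ * f zero + ∑ (λ j → δ (suc i) (suc j) * f (suc j)) ≡⟨ cong₂ _+_ (*-zeroˡ (f zero))
      (∑-cong (λ j → cong (_* f (suc j)) (δ-suc i j))) ⟩
  0ℚ + ∑ (λ j → δ i j * f (suc j))                      ≡⟨ +-identityˡ _ ⟩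
  ∑ (λ j → δ i j * f (suc j))                           ≡⟨ ∑-δˡ i (f ∘ suc) ⟩
  f (suc i)                                             ∎
  where open ≡-Reasoning

∑-δʳ : ∀ {k} (i : Fin k) (f : Fin k → ℚ) → ∑ (λ j → f j * δ j i) ≡ f i
∑-δʳ i f = trans (∑-cong (λ j → trans (*-comm (f j) (δ j i)) (cong (_* f j) (δ-sym j i))))
                 (∑-δˡ i f)

module _ {a b : ℕ} where

  ≈ₘ-refl : {M : Matrix a b} → M ≈ₘ M
  ≈ₘ-refl i j = refl

  ≈ₘ-sym : {M N : Matrix a b} → M ≈ₘ N → N ≈ₘ M
  ≈ₘ-sym M≈N i j = sym (M≈N i j)

  ≈ₘ-trans : {M N K : Matrix a b} → M ≈ₘ N → N ≈ₘ K → M ≈ₘ K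
  ≈ₘ-trans M≈N N≈K i j = trans (M≈N i j) (N≈K i j)

  ⊕-cong : {M M′ N N′ : Matrix a b} → M ≈ₘ M′ → N ≈ₘ N′ → M ⊕ N ≈ₘ M′ ⊕ N′
  ⊕-cong M≈M′ N≈N′ i j = cong₂ _+_ (M≈M′ i j) (N≈N′ i j)

  ⊖-cong : {M M′ N N′ : Matrix a b} → M ≈ₘ M′ → N ≈ₘ N′ → M ⊖ N ≈ₘ M′ ⊖ N′
  ⊖-cong M≈M′ N≈N′ i j = cong₂ _-_ (M≈M′ i j) (N≈N′ i j)

  ⊕-congˡ : (M : Matrix a b) {N N′ : Matrix a b} → N ≈ₘ N′ → M ⊕ N ≈ₘ M ⊕ N′
  ⊕-congˡ M = ⊕-cong (≈ₘ-refl {M = M})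

  ⊕-congʳ : (N : Matrix a b) {M M′ : Matrix a b} → M ≈ₘ M′ → M ⊕ N ≈ₘ M′ ⊕ N
  ⊕-congʳ N M≈M′ = ⊕-cong M≈M′ (≈ₘ-refl {M = N})

  ⊖-congˡ : (M : Matrix a b) {N N′ : Matrix a b} → N ≈ₘ N′ → M ⊖ N ≈ₘ M ⊖ N′
  ⊖-congˡ M = ⊖-cong (≈ₘ-refl {M = M})

  ⊖-congʳ : (N : Matrix a b) {M M′ : Matrix a b} → M ≈ₘ M′ → M ⊖ N ≈ₘ M′ ⊖ N
  ⊖-congʳ N M≈M′ = ⊖-cong M≈M′ (≈ₘ-refl {M = N})

  ⊖-cancel-⊕ : (M N : Matrix a b) → M ⊖ M ⊕ N ≈ₘ N
  ⊖-cancel-⊕ M N i j = solve 2 (λ m n → m :- m :+ n := n) refl (M i j) (N i j)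

  ⊖-⊕-transpose : {M N K L : Matrix a b} → M ≈ₘ N ⊖ K ⊕ L → N ≈ₘ M ⊕ K ⊖ L
  ⊖-⊕-transpose {M} {N} {K} {L} M≈N-K+L i j = begin
    N i j                                   ≡⟨ solve 3 (λ n k l → n := (n :- k :+ l) :+ k :- l) refl
                                                       (N i j) (K i j) (L i j) ⟩
    (N i j - K i j + L i j) + K i j - L i j ≡⟨ cong (λ m → m + K i j - L i j) (sym (M≈N-K+L i j)) ⟩
    M i j + K i j - L i j                   ∎
    where open ≡-Reasoning

  ⊗-identityˡ : (M : Matrix a b) → Id ⊗ M ≈ₘ M
  ⊗-identityˡ M i j = ∑-δˡ i (λ k → M k j)

  ⊗-identityʳ : (M : Matrix a b) → M ⊗ Id ≈ₘ M
  ⊗-identityʳ M i j = ∑-δʳ j (M i)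

≈ₘ-setoid : ℕ → ℕ → Setoid _ _
≈ₘ-setoid a b = record
  { Carrier       = Matrix a b
  ; _≈_           = _≈ₘ_
  ; isEquivalence = record { refl = ≈ₘ-refl ; sym = ≈ₘ-sym ; trans = ≈ₘ-trans }
  }

module _ {a b c : ℕ} where

  ⊗-congˡ : (M : Matrix a b) {N N′ : Matrix b c} → N ≈ₘ N′ → M ⊗ N ≈ₘ M ⊗ N′
  ⊗-congˡ M N≈N′ i j = ∑-cong (λ k → cong (M i k *_) (N≈N′ k j))

  ⊗-congʳ : (N : Matrix b c) {M M′ : Matrix a b} → M ≈ₘ M′ → M ⊗ N ≈ₘ M′ ⊗ N
  ⊗-congʳ N M≈M′ i j = ∑-cong (λ k → cong (_* N k j) (M≈M′ i k))

  ⊗-distribˡ-⊕ : (M : Matrix a b) (N K : Matrix b c) → M ⊗ (N ⊕ K) ≈ₘ M ⊗ N ⊕ M ⊗ K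
  ⊗-distribˡ-⊕ M N K i j =
    trans (∑-cong (λ k → *-distribˡ-+ (M i k) (N k j) (K k j)))
          (∑-distrib-+ (λ k → M i k * N k j) (λ k → M i k * K k j))

  ⊗-distribˡ-⊖ : (M : Matrix a b) (N K : Matrix b c) → M ⊗ (N ⊖ K) ≈ₘ M ⊗ N ⊖ M ⊗ K
  ⊗-distribˡ-⊖ M N K i j =
    trans (∑-cong (λ k → solve 3 (λ m n p → m :* (n :- p) := m :* n :- m :* p) refl
                                   (M i k) (N k j) (K k j)))
          (∑-distrib-- (λ k → M i k * N k j) (λ k → M i k * K k j))

  ⊗-distribʳ-⊕ : (M N : Matrix a b) (K : Matrix b c) → (M ⊕ N) ⊗ K ≈ₘ M ⊗ K ⊕ N ⊗ K
  ⊗-distribʳ-⊕ M N K i j =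
    trans (∑-cong (λ k → solve 3 (λ m n p → (m :+ n) :* p := m :* p :+ n :* p) refl
                                   (M i k) (N i k) (K k j)))
          (∑-distrib-+ (λ k → M i k * K k j) (λ k → N i k * K k j))

  ⊗-distribʳ-⊖ : (M N : Matrix a b) (K : Matrix b c) → (M ⊖ N) ⊗ K ≈ₘ M ⊗ K ⊖ N ⊗ K
  ⊗-distribʳ-⊖ M N K i j =
    trans (∑-cong (λ k → solve 3 (λ m n p → (m :- n) :* p := m :* p :- n :* p) refl
                                   (M i k) (N i k) (K k j)))
          (∑-distrib-- (λ k → M i k * K k j) (λ k → N i k * K k j))

⊗-assoc : ∀ {a b c d} (M : Matrix a b) (N : Matrix b c) (K : Matrix c d) →
          (M ⊗ N) ⊗ K ≈ₘ M ⊗ (N ⊗ K)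
⊗-assoc M N K i j = begin
  ∑ (λ l → ∑ (λ k → M i k * N k l) * K l j)   ≡⟨ ∑-cong (λ l → sym (*-distribʳ-∑ (K l j) (λ k → M i k * N k l))) ⟩
  ∑ (λ l → ∑ (λ k → M i k * N k l * K l j))   ≡⟨ ∑-comm (λ l k → M i k * N k l * K l j) ⟩
  ∑ (λ k → ∑ (λ l → M i k * N k l * K l j))   ≡⟨ ∑-cong (λ k → ∑-cong (λ l → *-assoc (M i k) (N k l) (K l j))) ⟩
  ∑ (λ k → ∑ (λ l → M i k * (N k l * K l j))) ≡⟨ ∑-cong (λ k → *-distribˡ-∑ (M i k) (λ l → N k l * K l j)) ⟩
  ∑ (λ k → M i k * ∑ (λ l → N k l * K l j))   ∎
  where open ≡-Reasoning

module _ {a b c : ℕ} where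

  ⊗-distribˡ-⊖⊕ : (M : Matrix a b) (N K L : Matrix b c) → M ⊗ (N ⊖ K ⊕ L) ≈ₘ M ⊗ N ⊖ M ⊗ K ⊕ M ⊗ L
  ⊗-distribˡ-⊖⊕ M N K L =
    ≈ₘ-trans (⊗-distribˡ-⊕ M (N ⊖ K) L) (⊕-congʳ (M ⊗ L) (⊗-distribˡ-⊖ M N K))

  ⊗-distribʳ-⊖⊕ : (N K L : Matrix a b) (M : Matrix b c) → (N ⊖ K ⊕ L) ⊗ M ≈ₘ N ⊗ M ⊖ K ⊗ M ⊕ L ⊗ M
  ⊗-distribʳ-⊖⊕ N K L M =
    ≈ₘ-trans (⊗-distribʳ-⊕ (N ⊖ K) L M) (⊕-congʳ (L ⊗ M) (⊗-distribʳ-⊖ N K M))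

module _ {a b : ℕ} where

  ⊗-distribˡ-Id⊖⊕ : (M : Matrix a b) (N K : Matrix b b) → M ⊗ (Id ⊖ N ⊕ K) ≈ₘ M ⊖ M ⊗ N ⊕ M ⊗ K
  ⊗-distribˡ-Id⊖⊕ M N K =
    ≈ₘ-trans (⊗-distribˡ-⊖⊕ M Id N K) (⊕-congʳ (M ⊗ K) (⊖-congʳ (M ⊗ N) (⊗-identityʳ M)))

  ⊗-distribʳ-Id⊖⊕ : (N K : Matrix a a) (M : Matrix a b) → (Id ⊖ N ⊕ K) ⊗ M ≈ₘ M ⊖ N ⊗ M ⊕ K ⊗ M
  ⊗-distribʳ-Id⊖⊕ N K M =
    ≈ₘ-trans (⊗-distribʳ-⊖⊕ Id N K M) (⊕-congʳ (K ⊗ M) (⊖-congʳ (N ⊗ M) (⊗-identityˡ M)))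

left-inverse≈right-inverse : ∀ {k} {Y M Z : Matrix k k} → Y ⊗ M ≈ₘ Id → M ⊗ Z ≈ₘ Id → Y ≈ₘ Z
left-inverse≈right-inverse {k} {Y} {M} {Z} YM≈I MZ≈I = begin
  Y              ≈⟨ ≈ₘ-sym (⊗-identityʳ Y) ⟩
  Y ⊗ Id         ≈⟨ ⊗-congˡ Y (≈ₘ-sym MZ≈I) ⟩
  Y ⊗ (M ⊗ Z)    ≈⟨ ≈ₘ-sym (⊗-assoc Y M Z) ⟩
  (Y ⊗ M) ⊗ Z    ≈⟨ ⊗-congʳ Z YM≈I ⟩
  Id ⊗ Z         ≈⟨ ⊗-identityˡ Z ⟩
  Z              ∎
  where open SetoidReasoning (≈ₘ-setoid k k)

left-inverse-fixes : ∀ {k l} {Z M : Matrix k k} {V : Matrix k l} → Z ⊗ M ≈ₘ Id → M ⊗ V ≈ₘ V → Z ⊗ V ≈ₘ V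
left-inverse-fixes {k} {l} {Z} {M} {V} ZM≈I MV≈V = begin
  Z ⊗ V          ≈⟨ ⊗-congˡ Z (≈ₘ-sym MV≈V) ⟩
  Z ⊗ (M ⊗ V)    ≈⟨ ≈ₘ-sym (⊗-assoc Z M V) ⟩
  (Z ⊗ M) ⊗ V    ≈⟨ ⊗-congʳ V ZM≈I ⟩
  Id ⊗ V         ≈⟨ ⊗-identityˡ V ⟩
  V              ∎
  where open SetoidReasoning (≈ₘ-setoid k l)

-- The matrix 𝟙vᵀ; Wᵥ and Wₑ are definitionally of this form.
rows : ∀ {a b} → (Fin b → ℚ) → Matrix a b
rows v i j = v j

RowStochastic : ∀ {a b} → Matrix a b → Set
RowStochastic M = ∀ i → ∑ (M i) ≡ 1ℚ

⊗-rows : ∀ {a b c} (M : Matrix a b) (v : Fin c → ℚ) → RowStochastic M → M ⊗ rows v ≈ₘ rows v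
⊗-rows M v stochastic i j =
  trans (*-distribʳ-∑ (v j) (M i)) (trans (cong (_* v j) (stochastic i)) (*-identityˡ (v j)))

∑ₗ : {X : Set} → (X → ℚ) → List X → ℚ
∑ₗ h xs = ∑ (λ i → h (lookup xs i))

∑ₗ-filterᵇ : {X : Set} (p : X → Bool) (h : X → ℚ) (xs : List X) →
             ∑ₗ h (filterᵇ p xs) ≡ ∑ₗ (λ x → if p x then h x else 0ℚ) xs
∑ₗ-filterᵇ p h [] = refl
∑ₗ-filterᵇ p h (x ∷ xs) with p x
... | true  = cong (h x +_) (∑ₗ-filterᵇ p h xs)
... | false = trans (∑ₗ-filterᵇ p h xs) (sym (+-identityˡ _))

∑ₗ-++ : {X : Set} (h : X → ℚ) (xs ys : List X) → ∑ₗ h (xs ++ ys) ≡ ∑ₗ h xs + ∑ₗ h ys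
∑ₗ-++ h []       ys = sym (+-identityˡ _)
∑ₗ-++ h (x ∷ xs) ys rewrite ∑ₗ-++ h xs ys =
  solve 3 (λ a b c → a :+ (b :+ c) := (a :+ b) :+ c) refl (h x) (∑ₗ h xs) (∑ₗ h ys)

∑ₗ-map : {X Y : Set} (h : Y → ℚ) (g : X → Y) (xs : List X) → ∑ₗ h (map g xs) ≡ ∑ₗ (h ∘ g) xs
∑ₗ-map h g []       = refl
∑ₗ-map h g (x ∷ xs) = cong (h (g x) +_) (∑ₗ-map h g xs)

∑ₗ-cartesianProduct : {X Y : Set} (h : X × Y → ℚ) (xs : List X) (ys : List Y) →
  ∑ₗ h (cartesianProduct xs ys) ≡ ∑ₗ (λ x → ∑ₗ (λ y → h (x , y)) ys) xs
∑ₗ-cartesianProduct h []       ys = refl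
∑ₗ-cartesianProduct h (x ∷ xs) ys =
  trans (∑ₗ-++ h (map (x ,_) ys) (cartesianProduct xs ys))
        (cong₂ _+_ (∑ₗ-map h (x ,_) ys) (∑ₗ-cartesianProduct h xs ys))

∑ₗ-tabulate : {X : Set} {k : ℕ} (f : Fin k → X) (h : X → ℚ) → ∑ₗ h (tabulate f) ≡ ∑ (h ∘ f)
∑ₗ-tabulate {k = zero}  f h = refl
∑ₗ-tabulate {k = suc k} f h = cong (h (f zero) +_) (∑ₗ-tabulate (f ∘ suc) h)

length-nonZero : {X : Set} {x : X} {xs : List X} → x ∈ xs → NonZero (length xs)
length-nonZero (here _)  = _
length-nonZero (there _) = _

if-as-* : ∀ (b : Bool) (q : ℚ) → (if b then q else 0ℚ) ≡ (if b then 1ℚ else 0ℚ) * q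
if-as-* true  q = sym (*-identityˡ q)
if-as-* false q = sym (*-zeroˡ q)

module _ {n : ℕ} (A : Adjacency n) where
  open Walks A

  degℚ : Fin n → ℚ
  degℚ x = ℕtoℚ (deg x)

  degℚ≡∑ : ∀ x → degℚ x ≡ ∑ (Aℚ x)
  degℚ≡∑ x = begin
    ℕtoℚ (deg x)                                    ≡⟨ sym (*-identityʳ _) ⟩
    ℕtoℚ (deg x) * 1ℚ                               ≡⟨ sym (∑-const (deg x) 1ℚ) ⟩
    ∑ₗ (λ _ → 1ℚ) (filterᵇ (A x) (allFin n))         ≡⟨ ∑ₗ-filterᵇ (A x) (λ _ → 1ℚ) (allFin n) ⟩
    ∑ₗ (λ y → if A x y then 1ℚ else 0ℚ) (allFin n)  ≡⟨ ∑ₗ-tabulate id (λ y → if A x y then 1ℚ else 0ℚ) ⟩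
    ∑ (Aℚ x)                                        ∎
    where open ≡-Reasoning

  ∑-dedges : ∀ (g : Fin n → Fin n → ℚ) →
             ∑ (λ e → g (tail e) (head e)) ≡ ∑ (λ x → ∑ (λ y → Aℚ x y * g x y))
  ∑-dedges g = begin
    ∑ₗ g′ (filterᵇ (λ p → A (proj₁ p) (proj₂ p)) (cartesianProduct (allFin n) (allFin n)))
      ≡⟨ ∑ₗ-filterᵇ _ g′ (cartesianProduct (allFin n) (allFin n)) ⟩
    ∑ₗ (λ p → masked (proj₁ p) (proj₂ p)) (cartesianProduct (allFin n) (allFin n))
      ≡⟨ ∑ₗ-cartesianProduct (λ p → masked (proj₁ p) (proj₂ p)) (allFin n) (allFin n) ⟩
    ∑ₗ (λ x → ∑ₗ (masked x) (allFin n)) (allFin n)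
      ≡⟨ ∑ₗ-tabulate id (λ x → ∑ₗ (masked x) (allFin n)) ⟩
    ∑ (λ x → ∑ₗ (masked x) (allFin n))
      ≡⟨ ∑-cong (λ x → trans (∑ₗ-tabulate id (masked x)) (∑-cong (λ y → if-as-* (A x y) (g x y)))) ⟩
    ∑ (λ x → ∑ (λ y → Aℚ x y * g x y))
      ∎
    where
    open ≡-Reasoning
    g′ : Fin n × Fin n → ℚ
    g′ p = g (proj₁ p) (proj₂ p)
    masked : Fin n → Fin n → ℚ
    masked x y = if A x y then g x y else 0ℚ

  ∑-degℚ : ∑ degℚ ≡ ℕtoℚ 2m
  ∑-degℚ = begin
    ∑ degℚ                                  ≡⟨ ∑-cong degℚ≡∑ ⟩
    ∑ (λ x → ∑ (Aℚ x))                      ≡⟨ ∑-cong (λ x → ∑-cong (λ y → sym (*-identityʳ (Aℚ x y)))) ⟩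
    ∑ (λ x → ∑ (λ y → Aℚ x y * 1ℚ))         ≡⟨ sym (∑-dedges (λ _ _ → 1ℚ)) ⟩
    ∑ {2m} (λ _ → 1ℚ)                       ≡⟨ ∑-const 2m 1ℚ ⟩
    ℕtoℚ 2m * 1ℚ                            ≡⟨ *-identityʳ _ ⟩
    ℕtoℚ 2m                                 ∎
    where open ≡-Reasoning

  ∑-δ-tail : ∀ x → ∑ (λ e → δ (tail e) x) ≡ degℚ x
  ∑-δ-tail x = begin
    ∑ (λ e → δ (tail e) x)                     ≡⟨ ∑-dedges (λ y _ → δ y x) ⟩
    ∑ (λ y → ∑ (λ z → Aℚ y z * δ y x))         ≡⟨ ∑-cong (λ y → *-distribʳ-∑ (δ y x) (Aℚ y)) ⟩
    ∑ (λ y → ∑ (Aℚ y) * δ y x)                 ≡⟨ ∑-cong (λ y → cong (_* δ y x) (sym (degℚ≡∑ y))) ⟩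
    ∑ (λ y → degℚ y * δ y x)                   ≡⟨ ∑-δʳ x degℚ ⟩
    degℚ x                                     ∎
    where open ≡-Reasoning

  Dm : Matrix n n
  Dm x y = δ x y * degℚ x

  T⊗S≈Aℚ : T ⊗ S ≈ₘ Aℚ
  T⊗S≈Aℚ x y = begin
    ∑ (λ e → δ (tail e) x * δ (head e) y)              ≡⟨ ∑-dedges (λ z w → δ z x * δ w y) ⟩
    ∑ (λ z → ∑ (λ w → Aℚ z w * (δ z x * δ w y)))       ≡⟨ ∑-cong (λ z → ∑-cong (λ w →
        solve 3 (λ a p q → a :* (p :* q) := (a :* q) :* p) refl (Aℚ z w) (δ z x) (δ w y))) ⟩
    ∑ (λ z → ∑ (λ w → Aℚ z w * δ w y * δ z x))         ≡⟨ ∑-cong (λ z → *-distribʳ-∑ (δ z x) (λ w → Aℚ z w * δ w y)) ⟩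
    ∑ (λ z → ∑ (λ w → Aℚ z w * δ w y) * δ z x)         ≡⟨ ∑-cong (λ z → cong (_* δ z x) (∑-δʳ y (Aℚ z))) ⟩
    ∑ (λ z → Aℚ z y * δ z x)                           ≡⟨ ∑-δʳ x (λ z → Aℚ z y) ⟩
    Aℚ x y                                             ∎
    where open ≡-Reasoning

  T⊗Tᵀ≈Dm : T ⊗ T ᵀ ≈ₘ Dm
  T⊗Tᵀ≈Dm x y = begin
    ∑ (λ e → δ (tail e) x * δ (tail e) y)              ≡⟨ ∑-dedges (λ z _ → δ z x * δ z y) ⟩
    ∑ (λ z → ∑ (λ w → Aℚ z w * (δ z x * δ z y)))       ≡⟨ ∑-cong (λ z → *-distribʳ-∑ (δ z x * δ z y) (Aℚ z)) ⟩
    ∑ (λ z → ∑ (Aℚ z) * (δ z x * δ z y))               ≡⟨ ∑-cong (λ z → cong (_* (δ z x * δ z y)) (sym (degℚ≡∑ z))) ⟩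
    ∑ (λ z → degℚ z * (δ z x * δ z y))                 ≡⟨ ∑-cong (λ z →
        solve 3 (λ d p q → d :* (p :* q) := (q :* d) :* p) refl (degℚ z) (δ z x) (δ z y)) ⟩
    ∑ (λ z → δ z y * degℚ z * δ z x)                   ≡⟨ ∑-δʳ x (λ z → δ z y * degℚ z) ⟩
    δ x y * degℚ x                                     ∎
    where open ≡-Reasoning

  ∑-column≡degℚ : Symmetric A → ∀ y → ∑ (λ x → Aℚ x y) ≡ degℚ y
  ∑-column≡degℚ symmetric y =
    trans (∑-cong (λ x → cong (λ b → if b then 1ℚ else 0ℚ) (symmetric x y))) (sym (degℚ≡∑ y))

  ∑-δ-head : Symmetric A → ∀ y → ∑ (λ e → δ (head e) y) ≡ degℚ y
  ∑-δ-head symmetric y = trans (∑-dedges (λ _ w → δ w y))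
                               (trans (∑-cong (λ x → ∑-δʳ y (Aℚ x))) (∑-column≡degℚ symmetric y))

  Dinv⊗T-entry : ∀ x e → (Dinv ⊗ T) x e ≡ recipℕ (deg x) * δ (tail e) x
  Dinv⊗T-entry x e =
    trans (∑-cong (λ z → *-assoc (δ x z) (recipℕ (deg x)) (δ (tail e) z)))
          (∑-δˡ x (λ z → recipℕ (deg x) * δ (tail e) z))

  Dinv⊗T⊗S≈P : Dinv ⊗ T ⊗ S ≈ₘ P
  Dinv⊗T⊗S≈P = ≈ₘ-trans (⊗-assoc Dinv T S) (≈ₘ-trans (⊗-congˡ Dinv T⊗S≈Aℚ) Dinv⊗Aℚ≈P)
    where
    Dinv⊗Aℚ≈P : Dinv ⊗ Aℚ ≈ₘ P
    Dinv⊗Aℚ≈P x y =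
      trans (∑-cong (λ z → *-assoc (δ x z) (recipℕ (deg x)) (Aℚ z y)))
            (trans (∑-δˡ x (λ z → recipℕ (deg x) * Aℚ z y)) (*-comm (recipℕ (deg x)) (Aℚ x y)))

  Pe≈S⊗Dinv⊗T : Pe ≈ₘ S ⊗ (Dinv ⊗ T)
  Pe≈S⊗Dinv⊗T e f = sym (begin
    ∑ (λ x → δ (head e) x * (Dinv ⊗ T) x f)       ≡⟨ ∑-δˡ (head e) (λ x → (Dinv ⊗ T) x f) ⟩
    (Dinv ⊗ T) (head e) f                         ≡⟨ Dinv⊗T-entry (head e) f ⟩
    recipℕ (deg (head e)) * δ (tail f) (head e)   ≡⟨ *-comm (recipℕ (deg (head e))) (δ (tail f) (head e)) ⟩
    δ (tail f) (head e) * recipℕ (deg (head e))   ≡⟨ cong (_* recipℕ (deg (head e))) (δ-sym (tail f) (head e)) ⟩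
    δ (head e) (tail f) * recipℕ (deg (head e))   ∎)
    where open ≡-Reasoning

  S-stochastic : RowStochastic S
  S-stochastic e =
    trans (∑-cong (λ x → sym (*-identityʳ (δ (head e) x)))) (∑-δˡ (head e) (λ _ → 1ℚ))

  S⊗P≈Pe⊗S : S ⊗ P ≈ₘ Pe ⊗ S
  S⊗P≈Pe⊗S = begin
    S ⊗ P                  ≈⟨ ⊗-congˡ S (≈ₘ-sym Dinv⊗T⊗S≈P) ⟩
    S ⊗ (Dinv ⊗ T ⊗ S)     ≈⟨ ≈ₘ-sym (⊗-assoc S (Dinv ⊗ T) S) ⟩
    S ⊗ (Dinv ⊗ T) ⊗ S     ≈⟨ ⊗-congʳ S (≈ₘ-sym Pe≈S⊗Dinv⊗T) ⟩
    Pe ⊗ S                 ∎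
    where open SetoidReasoning (≈ₘ-setoid 2m n)

  Ve : Matrix 2m n
  Ve = rows π

  We⊗Tᵀ≈Ve : We ⊗ T ᵀ ≈ₘ Ve
  We⊗Tᵀ≈Ve e j = trans (*-distribˡ-∑ (recipℕ 2m) (λ f → δ (tail f) j))
                       (trans (cong (recipℕ 2m *_) (∑-δ-tail j)) (*-comm (recipℕ 2m) (degℚ j)))

  We⊗S≈Ve : Symmetric A → We ⊗ S ≈ₘ Ve
  We⊗S≈Ve symmetric e j = trans (*-distribˡ-∑ (recipℕ 2m) (λ f → δ (head f) j))
                                (trans (cong (recipℕ 2m *_) (∑-δ-head symmetric j)) (*-comm (recipℕ 2m) (degℚ j)))

  module _ (deg≢0 : ∀ x → NonZero (deg x)) (2m≢0 : NonZero 2m) where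

    recip-deg-inverse : ∀ x → recipℕ (deg x) * degℚ x ≡ 1ℚ
    recip-deg-inverse x = recipℕ-inverseˡ (deg x) {{deg≢0 x}}

    Dinv⊗T⊗Tᵀ≈Id : Dinv ⊗ T ⊗ T ᵀ ≈ₘ Id
    Dinv⊗T⊗Tᵀ≈Id = ≈ₘ-trans (⊗-assoc Dinv T (T ᵀ)) (≈ₘ-trans (⊗-congˡ Dinv T⊗Tᵀ≈Dm) Dinv⊗Dm≈Id)
      where
      Dinv⊗Dm≈Id : Dinv ⊗ Dm ≈ₘ Id
      Dinv⊗Dm≈Id x y = begin
        ∑ (λ z → δ x z * recipℕ (deg x) * (δ z y * degℚ z))     ≡⟨ ∑-cong (λ z → *-assoc (δ x z) _ _) ⟩
        ∑ (λ z → δ x z * (recipℕ (deg x) * (δ z y * degℚ z)))   ≡⟨ ∑-δˡ x (λ z → recipℕ (deg x) * (δ z y * degℚ z)) ⟩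
        recipℕ (deg x) * (δ x y * degℚ x)                       ≡⟨ solve 3 (λ r p d → r :* (p :* d) := p :* (r :* d)) refl
                                                                     (recipℕ (deg x)) (δ x y) (degℚ x) ⟩
        δ x y * (recipℕ (deg x) * degℚ x)                       ≡⟨ cong (δ x y *_) (recip-deg-inverse x) ⟩
        δ x y * 1ℚ                                              ≡⟨ *-identityʳ (δ x y) ⟩
        δ x y                                                   ∎
        where open ≡-Reasoning

    Dinv⊗T-stochastic : RowStochastic (Dinv ⊗ T)
    Dinv⊗T-stochastic x = begin
      ∑ ((Dinv ⊗ T) x)                         ≡⟨ ∑-cong (Dinv⊗T-entry x) ⟩
      ∑ (λ e → recipℕ (deg x) * δ (tail e) x)  ≡⟨ *-distribˡ-∑ (recipℕ (deg x)) (λ e → δ (tail e) x) ⟩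
      recipℕ (deg x) * ∑ (λ e → δ (tail e) x)  ≡⟨ cong (recipℕ (deg x) *_) (∑-δ-tail x) ⟩
      recipℕ (deg x) * degℚ x                  ≡⟨ recip-deg-inverse x ⟩
      1ℚ                                       ∎
      where open ≡-Reasoning

    We-stochastic : RowStochastic We
    We-stochastic e = trans (∑-const 2m (recipℕ 2m))
                            (trans (*-comm (ℕtoℚ 2m) (recipℕ 2m)) (recipℕ-inverseˡ 2m {{2m≢0}}))

    Wv-stochastic : RowStochastic Wv
    Wv-stochastic i = begin
      ∑ (λ x → degℚ x * recipℕ 2m)   ≡⟨ *-distribʳ-∑ (recipℕ 2m) degℚ ⟩
      ∑ degℚ * recipℕ 2m             ≡⟨ cong (_* recipℕ 2m) ∑-degℚ ⟩
      ℕtoℚ 2m * recipℕ 2m            ≡⟨ *-comm (ℕtoℚ 2m) (recipℕ 2m) ⟩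
      recipℕ 2m * ℕtoℚ 2m            ≡⟨ recipℕ-inverseˡ 2m {{2m≢0}} ⟩
      1ℚ                             ∎
      where open ≡-Reasoning

    Pe⊗Tᵀ≈S : Pe ⊗ T ᵀ ≈ₘ S
    Pe⊗Tᵀ≈S = begin
      Pe ⊗ T ᵀ                 ≈⟨ ⊗-congʳ (T ᵀ) Pe≈S⊗Dinv⊗T ⟩
      S ⊗ (Dinv ⊗ T) ⊗ T ᵀ     ≈⟨ ⊗-assoc S (Dinv ⊗ T) (T ᵀ) ⟩
      S ⊗ (Dinv ⊗ T ⊗ T ᵀ)     ≈⟨ ⊗-congˡ S Dinv⊗T⊗Tᵀ≈Id ⟩
      S ⊗ Id                   ≈⟨ ⊗-identityʳ S ⟩
      S                        ∎
      where open SetoidReasoning (≈ₘ-setoid 2m n)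

    Pe⊗Ve≈Ve : Pe ⊗ Ve ≈ₘ Ve
    Pe⊗Ve≈Ve = begin
      Pe ⊗ Ve                  ≈⟨ ⊗-congʳ Ve Pe≈S⊗Dinv⊗T ⟩
      S ⊗ (Dinv ⊗ T) ⊗ Ve      ≈⟨ ⊗-assoc S (Dinv ⊗ T) Ve ⟩
      S ⊗ (Dinv ⊗ T ⊗ Ve)      ≈⟨ ⊗-congˡ S (⊗-rows (Dinv ⊗ T) π Dinv⊗T-stochastic) ⟩
      S ⊗ Wv                   ≈⟨ ⊗-rows S π S-stochastic ⟩
      Ve                       ∎
      where open SetoidReasoning (≈ₘ-setoid 2m n)

    Me⊗Tᵀ≈Tᵀ⊖S⊕Ve : Me ⊗ T ᵀ ≈ₘ T ᵀ ⊖ S ⊕ Ve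
    Me⊗Tᵀ≈Tᵀ⊖S⊕Ve =
      ≈ₘ-trans (⊗-distribʳ-Id⊖⊕ Pe We (T ᵀ)) (⊕-cong (⊖-congˡ (T ᵀ) Pe⊗Tᵀ≈S) We⊗Tᵀ≈Ve)

    Me⊗Ve≈Ve : Me ⊗ Ve ≈ₘ Ve
    Me⊗Ve≈Ve = begin
      Me ⊗ Ve                      ≈⟨ ⊗-distribʳ-Id⊖⊕ Pe We Ve ⟩
      Ve ⊖ Pe ⊗ Ve ⊕ We ⊗ Ve       ≈⟨ ⊕-cong (⊖-congˡ Ve Pe⊗Ve≈Ve) (⊗-rows We π We-stochastic) ⟩
      Ve ⊖ Ve ⊕ Ve                 ≈⟨ ⊖-cancel-⊕ Ve Ve ⟩
      Ve                           ∎
      where open SetoidReasoning (≈ₘ-setoid 2m n)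

    Ze⊗Tᵀ≈Tᵀ⊕Ze⊗S⊖Ve : (Ze : Matrix 2m 2m) → Ze ⊗ Me ≈ₘ Id → Ze ⊗ T ᵀ ≈ₘ T ᵀ ⊕ Ze ⊗ S ⊖ Ve
    Ze⊗Tᵀ≈Tᵀ⊕Ze⊗S⊖Ve Ze Ze⊗Me≈Id = ⊖-⊕-transpose (begin
      T ᵀ                              ≈⟨ ≈ₘ-sym (⊗-identityˡ (T ᵀ)) ⟩
      Id ⊗ T ᵀ                         ≈⟨ ⊗-congʳ (T ᵀ) (≈ₘ-sym Ze⊗Me≈Id) ⟩
      Ze ⊗ Me ⊗ T ᵀ                    ≈⟨ ⊗-assoc Ze Me (T ᵀ) ⟩
      Ze ⊗ (Me ⊗ T ᵀ)                  ≈⟨ ⊗-congˡ Ze Me⊗Tᵀ≈Tᵀ⊖S⊕Ve ⟩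
      Ze ⊗ (T ᵀ ⊖ S ⊕ Ve)              ≈⟨ ⊗-distribˡ-⊖⊕ Ze (T ᵀ) S Ve ⟩
      Ze ⊗ T ᵀ ⊖ Ze ⊗ S ⊕ Ze ⊗ Ve      ≈⟨ ⊕-congˡ (Ze ⊗ T ᵀ ⊖ Ze ⊗ S)
                                             (left-inverse-fixes {Z = Ze} {M = Me} Ze⊗Me≈Id Me⊗Ve≈Ve) ⟩
      Ze ⊗ T ᵀ ⊖ Ze ⊗ S ⊕ Ve           ∎)
      where open SetoidReasoning (≈ₘ-setoid 2m n)

    Dinv⊗T⊗Ze⊗Tᵀ≈Id⊕Dinv⊗T⊗Ze⊗S⊖Wv : (Ze : Matrix 2m 2m) → Ze ⊗ Me ≈ₘ Id →
      Dinv ⊗ T ⊗ Ze ⊗ T ᵀ ≈ₘ Id ⊕ Dinv ⊗ T ⊗ Ze ⊗ S ⊖ Wv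
    Dinv⊗T⊗Ze⊗Tᵀ≈Id⊕Dinv⊗T⊗Ze⊗S⊖Wv Ze Ze⊗Me≈Id = begin
      Dinv ⊗ T ⊗ Ze ⊗ T ᵀ                           ≈⟨ ⊗-assoc (Dinv ⊗ T) Ze (T ᵀ) ⟩
      Dinv ⊗ T ⊗ (Ze ⊗ T ᵀ)                         ≈⟨ ⊗-congˡ (Dinv ⊗ T) (Ze⊗Tᵀ≈Tᵀ⊕Ze⊗S⊖Ve Ze Ze⊗Me≈Id) ⟩
      Dinv ⊗ T ⊗ (T ᵀ ⊕ Ze ⊗ S ⊖ Ve)                ≈⟨ ⊗-distribˡ-⊖ (Dinv ⊗ T) (T ᵀ ⊕ Ze ⊗ S) Ve ⟩
      Dinv ⊗ T ⊗ (T ᵀ ⊕ Ze ⊗ S) ⊖ Dinv ⊗ T ⊗ Ve     ≈⟨ ⊖-cong (⊗-distribˡ-⊕ (Dinv ⊗ T) (T ᵀ) (Ze ⊗ S))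
                                                               (⊗-rows (Dinv ⊗ T) π Dinv⊗T-stochastic) ⟩
      Dinv ⊗ T ⊗ T ᵀ ⊕ Dinv ⊗ T ⊗ (Ze ⊗ S) ⊖ Wv     ≈⟨ ⊖-congʳ Wv (⊕-cong Dinv⊗T⊗Tᵀ≈Id
                                                               (≈ₘ-sym (⊗-assoc (Dinv ⊗ T) Ze S))) ⟩
      Id ⊕ Dinv ⊗ T ⊗ Ze ⊗ S ⊖ Wv                   ∎
      where open SetoidReasoning (≈ₘ-setoid n n)

    module _ (symmetric : Symmetric A) where

      π-stationary : Wv ⊗ P ≈ₘ Wv
      π-stationary _ y = begin
        ∑ (λ x → degℚ x * recipℕ 2m * (Aℚ x y * recipℕ (deg x)))   ≡⟨ ∑-cong (λ x →
            solve 4 (λ d m a r → d :* m :* (a :* r) := m :* a :* (r :* d)) refl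
              (degℚ x) (recipℕ 2m) (Aℚ x y) (recipℕ (deg x))) ⟩
        ∑ (λ x → recipℕ 2m * Aℚ x y * (recipℕ (deg x) * degℚ x))   ≡⟨ ∑-cong (λ x →
            trans (cong (recipℕ 2m * Aℚ x y *_) (recip-deg-inverse x)) (*-identityʳ _)) ⟩
        ∑ (λ x → recipℕ 2m * Aℚ x y)                               ≡⟨ *-distribˡ-∑ (recipℕ 2m) (λ x → Aℚ x y) ⟩
        recipℕ 2m * ∑ (λ x → Aℚ x y)                               ≡⟨ cong (recipℕ 2m *_) (∑-column≡degℚ symmetric y) ⟩
        recipℕ 2m * degℚ y                                         ≡⟨ *-comm (recipℕ 2m) (degℚ y) ⟩
        degℚ y * recipℕ 2m                                         ∎
        where open ≡-Reasoning

      Wv⊗Mv≈Wv : Wv ⊗ Mv ≈ₘ Wv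
      Wv⊗Mv≈Wv = begin
        Wv ⊗ Mv                    ≈⟨ ⊗-distribˡ-Id⊖⊕ Wv P Wv ⟩
        Wv ⊖ Wv ⊗ P ⊕ Wv ⊗ Wv      ≈⟨ ⊕-cong (⊖-congˡ Wv π-stationary) (⊗-rows Wv π Wv-stochastic) ⟩
        Wv ⊖ Wv ⊕ Wv               ≈⟨ ⊖-cancel-⊕ Wv Wv ⟩
        Wv                         ∎
        where open SetoidReasoning (≈ₘ-setoid n n)

      S⊗Mv≈Me⊗S : S ⊗ Mv ≈ₘ Me ⊗ S
      S⊗Mv≈Me⊗S = begin
        S ⊗ Mv                     ≈⟨ ⊗-distribˡ-Id⊖⊕ S P Wv ⟩
        S ⊖ S ⊗ P ⊕ S ⊗ Wv         ≈⟨ ⊕-cong (⊖-congˡ S S⊗P≈Pe⊗S)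
                                             (≈ₘ-trans (⊗-rows S π S-stochastic) (≈ₘ-sym (We⊗S≈Ve symmetric))) ⟩
        S ⊖ Pe ⊗ S ⊕ We ⊗ S        ≈⟨ ≈ₘ-sym (⊗-distribʳ-Id⊖⊕ Pe We S) ⟩
        Me ⊗ S                     ∎
        where open SetoidReasoning (≈ₘ-setoid 2m n)

      Dinv⊗T⊗Ze⊗S⊗Mv≈P : (Ze : Matrix 2m 2m) → Ze ⊗ Me ≈ₘ Id → Dinv ⊗ T ⊗ Ze ⊗ S ⊗ Mv ≈ₘ P
      Dinv⊗T⊗Ze⊗S⊗Mv≈P Ze Ze⊗Me≈Id = begin
        Dinv ⊗ T ⊗ Ze ⊗ S ⊗ Mv          ≈⟨ ⊗-assoc (Dinv ⊗ T ⊗ Ze) S Mv ⟩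
        Dinv ⊗ T ⊗ Ze ⊗ (S ⊗ Mv)        ≈⟨ ⊗-congˡ (Dinv ⊗ T ⊗ Ze) S⊗Mv≈Me⊗S ⟩
        Dinv ⊗ T ⊗ Ze ⊗ (Me ⊗ S)        ≈⟨ ≈ₘ-sym (⊗-assoc (Dinv ⊗ T ⊗ Ze) Me S) ⟩
        Dinv ⊗ T ⊗ Ze ⊗ Me ⊗ S          ≈⟨ ⊗-congʳ S (⊗-assoc (Dinv ⊗ T) Ze Me) ⟩
        Dinv ⊗ T ⊗ (Ze ⊗ Me) ⊗ S        ≈⟨ ⊗-congʳ S (⊗-congˡ (Dinv ⊗ T) Ze⊗Me≈Id) ⟩
        Dinv ⊗ T ⊗ Id ⊗ S               ≈⟨ ⊗-congʳ S (⊗-identityʳ (Dinv ⊗ T)) ⟩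
        Dinv ⊗ T ⊗ S                    ≈⟨ Dinv⊗T⊗S≈P ⟩
        P                               ∎
        where open SetoidReasoning (≈ₘ-setoid n n)

      Id⊕Dinv⊗T⊗Ze⊗S⊖Wv-left-inverse : (Ze : Matrix 2m 2m) → Ze ⊗ Me ≈ₘ Id →
        (Id ⊕ Dinv ⊗ T ⊗ Ze ⊗ S ⊖ Wv) ⊗ Mv ≈ₘ Id
      Id⊕Dinv⊗T⊗Ze⊗S⊖Wv-left-inverse Ze Ze⊗Me≈Id = begin
        (Id ⊕ X ⊖ Wv) ⊗ Mv                 ≈⟨ ⊗-distribʳ-⊖ (Id ⊕ X) Wv Mv ⟩
        (Id ⊕ X) ⊗ Mv ⊖ Wv ⊗ Mv            ≈⟨ ⊖-cong (⊗-distribʳ-⊕ Id X Mv) Wv⊗Mv≈Wv ⟩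
        Id ⊗ Mv ⊕ X ⊗ Mv ⊖ Wv              ≈⟨ ⊖-congʳ Wv (⊕-cong (⊗-identityˡ Mv) (Dinv⊗T⊗Ze⊗S⊗Mv≈P Ze Ze⊗Me≈Id)) ⟩
        Mv ⊕ P ⊖ Wv                        ≈⟨ (λ i j → solve 3 (λ d p w → d :- p :+ w :+ p :- w := d) refl
                                                                   (δ i j) (P i j) (π j)) ⟩
        Id                                 ∎
        where
        open SetoidReasoning (≈ₘ-setoid n n)
        X : Matrix n n
        X = Dinv ⊗ T ⊗ Ze ⊗ S

first-step : ∀ {n} {A : Adjacency n} {x y} → Reach A x y → ¬ x ≡ y → ∃[ z ] A x z ≡ true
first-step here       x≢x = ⊥-elim (x≢x refl)
first-step (step a _) _   = _ , a

has-neighbour : ∀ {k} (A : Adjacency (suc (suc k))) → Connected A → ∀ x → ∃[ y ] A x y ≡ true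
has-neighbour A connected zero    = first-step (connected zero (suc zero)) (λ ())
has-neighbour A connected (suc x) = first-step (connected (suc x) zero) (λ ())

module _ {n : ℕ} (A : Adjacency n) (neighbour : ∀ x → ∃[ y ] A x y ≡ true) where
  open Walks A

  deg-nonZero : ∀ x → NonZero (deg x)
  deg-nonZero x = length-nonZero
    (∈-filter⁺ (T? ∘ A x) (∈-allFin (proj₁ (neighbour x))) (Equivalence.from T-≡ (proj₂ (neighbour x))))

  2m-nonZero : Fin n → NonZero 2m
  2m-nonZero x = length-nonZero
    (∈-filter⁺ (λ p → T? (A (proj₁ p) (proj₂ p)))
      (∈-cartesianProduct⁺ (∈-allFin x) (∈-allFin (proj₁ (neighbour x))))
      (Equivalence.from T-≡ (proj₂ (neighbour x))))

mainTheorem2 : (n : ℕ) (A : Adjacency n) → 2 ≤ n → Symmetric A → Loopless A → Connected A →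
    let open Walks A in
    (Z : Matrix n n) (Ze : Matrix 2m 2m) → IsInverse Z Mv → IsInverse Ze Me →
    (Z ≈ₘ Id ⊕ Dinv ⊗ T ⊗ Ze ⊗ S ⊖ Wv) × (Z ≈ₘ Dinv ⊗ T ⊗ Ze ⊗ (T ᵀ))
mainTheorem2 zero          A ()
mainTheorem2 (suc zero)    A (s≤s ())
mainTheorem2 (suc (suc k)) A _ symmetric _ connected Z Ze (_ , Mv⊗Z≈Id) (Ze⊗Me≈Id , _) =
  Z≈Id⊕Dinv⊗T⊗Ze⊗S⊖Wv ,
  ≈ₘ-trans Z≈Id⊕Dinv⊗T⊗Ze⊗S⊖Wv (≈ₘ-sym (Dinv⊗T⊗Ze⊗Tᵀ≈Id⊕Dinv⊗T⊗Ze⊗S⊖Wv A deg≢0 2m≢0 Ze Ze⊗Me≈Id))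
  where
  open Walks A

  deg≢0 : ∀ x → NonZero (deg x)
  deg≢0 = deg-nonZero A (has-neighbour A connected)

  2m≢0 : NonZero 2m
  2m≢0 = 2m-nonZero A (has-neighbour A connected) zero

  Z≈Id⊕Dinv⊗T⊗Ze⊗S⊖Wv : Z ≈ₘ Id ⊕ Dinv ⊗ T ⊗ Ze ⊗ S ⊖ Wv
  Z≈Id⊕Dinv⊗T⊗Ze⊗S⊖Wv = ≈ₘ-sym (left-inverse≈right-inverse {M = Mv}
    (Id⊕Dinv⊗T⊗Ze⊗S⊖Wv-left-inverse A deg≢0 2m≢0 symmetric Ze Ze⊗Me≈Id) Mv⊗Z≈Id)
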